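{- Let $a,b$ be relatively prime integers with $1<a<b$, let $S=\langle a,b\rangle=\{\lambda_1 a+\lambda_2 b:\lambda_1,\lambda_2\in\mathbb{N}\}$, and let $(u,v)$ be the definitely least solution of the Diophantine equation $ax+by=1$. Then the number of isolated gaps of $S$ is $\#I(S)=|uv|$.
   Context: $\mathbb{N}$ denotes the set of nonnegative integers. A gap of a numerical semigroup $S\subseteq\mathbb{N}$ is an element of $\mathbb{N}\setminus S$. An isolated gap of $S$ is a gap $x$ such that $x-1\in S$ and $x+1\in S$; $I(S)$ denotes the set of isolated gaps of $S$. A solution $(u,v)\in\mathbb{Z}^2$ of $ax+by=1$ is the definitely least solution if both $|u|$ and $|v|$ attain their least possible values among all integer solutions; such a solution exists and is unique, and it is the unique solution with $|u|\le b/2$ and $|v|\le a/2$. -}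

module Defs where

open import Data.Nat using (ℕ; suc; _+_; _*_; _≤_)
open import Data.Integer as ℤ using (ℤ; +_)
open import Data.Product using (∃; ∃-syntax; _×_; Σ-syntax)
open import Data.List using (List; length)
open import Data.List.Membership.Propositional using (_∈_)
open import Data.List.Relation.Unary.Unique.Propositional using (Unique)
open import Relation.Binary.PropositionalEquality using (_≡_)
open import Relation.Nullary using (¬_)
open import Function.Bundles using (_⇔_)

InSemigroup₂ : ℕ → ℕ → ℕ → Set
InSemigroup₂ a b x = ∃[ l₁ ] ∃[ l₂ ] x ≡ l₁ * a + l₂ * b

IsGap : (ℕ → Set) → ℕ → Set
IsGap S x = ¬ S x

-- x is an isolated gap: x gap, x-1 ∈ S and x+1 ∈ S (so x ≥ 1 necessarily)
IsIsolatedGap : (ℕ → Set) → ℕ → Set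
IsIsolatedGap S x = IsGap S x × Σ[ y ∈ ℕ ] (x ≡ suc y × S y) × S (suc x)

HasCardinality : (ℕ → Set) → ℕ → Set
HasCardinality P n =
  Σ[ L ∈ List ℕ ] Unique L × (∀ x → (x ∈ L ⇔ P x)) × length L ≡ n

IsSolution : ℤ → ℤ → ℤ → ℤ → Set
IsSolution a b u v = a ℤ.* u ℤ.+ b ℤ.* v ≡ + 1

IsDefinitelyLeastSolution : ℤ → ℤ → ℤ → ℤ → Set
IsDefinitelyLeastSolution a b u v =
  IsSolution a b u v ×
  (∀ x y → IsSolution a b x y → ℤ.∣ u ∣ ≤ ℤ.∣ x ∣ × ℤ.∣ v ∣ ≤ ℤ.∣ y ∣)

{-# OPTIONS --safe #-}
-- Let p = ∣u∣ and q = ∣v∣. Then p·a − q·b = ±1; swapping a and b (which fixes ⟨a,b⟩) we may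
-- assume p·a = q·b + 1, and minimality of (u, v) gives 2p ≤ b and 2q ≤ a. Put e = b − 2p and
-- d = a − 2q, so that e·a + 2 = d·b. By coprimality, i·a + j·b with 0 ≤ i < b and j < 0 is a gap.
-- If x − 1 = i·a + j·b and x is a gap, then j < q (else x = (i + p)·a + (j − q)·b) and i < e + p
-- (else x = (i − e − p)·a + (j + q + d)·b); if moreover x + 1 ∈ ⟨a,b⟩ then i ≥ e, since otherwise
-- x + 1 = (i + 2p)·a + (j − 2q)·b would be a gap. So the isolated gaps are exactly the p·q
-- distinct numbers (e + k)·a + m·b + 1 with k < p and m < q.

module Submission where

open import Data.Fin using (Fin; toℕ; fromℕ<)
open import Data.Fin.Properties using (toℕ<n; toℕ-injective; toℕ-fromℕ<)
open import Data.Integer as ℤ using (ℤ; +_; -[1+_]; _⊖_)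
import Data.Integer.Properties as ℤP
import Data.Integer.Tactic.RingSolver as ℤSolver
open import Data.List using (List; []; _∷_; _++_; length; map; cartesianProductWith; allFin)
open import Data.List.Membership.Propositional using (_∈_)
open import Data.List.Membership.Propositional.Properties
  using (∈-cartesianProductWith⁺; ∈-cartesianProductWith⁻; ∈-allFin)
open import Data.List.Properties using (length-++; length-map; length-tabulate)
open import Data.List.Relation.Unary.Unique.Propositional using (Unique)
open import Data.List.Relation.Unary.Unique.Propositional.Properties
  using (cartesianProductWith⁺; allFin⁺)
open import Data.Nat
open import Data.Nat.Coprimality as Coprimality using (Coprime; coprime-divisor)
open import Data.Nat.Divisibility using (divides; ∣⇒≤)
open import Data.Nat.Properties
open import Data.Nat.Tactic.RingSolver using (solve)
open import Data.Product as Product using (∃₂; _×_; _,_; proj₁; proj₂)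
open import Data.Sum using (_⊎_; inj₁; inj₂)
open import Function using (_∘_; id)
open import Function.Bundles using (mk⇔; Equivalence)
open import Relation.Binary.PropositionalEquality
open import Relation.Nullary using (¬_; yes; no; contradiction)

open import Defs

module _ {a b : ℕ} (coprime : Coprime a b) where

  n*a≡[1+r]*b⇒b≤n : ∀ n r → n * a ≡ suc r * b → b ≤ n
  n*a≡[1+r]*b⇒b≤n zero    r eq = ≤-reflexive (m+n≡0⇒m≡0 b (sym eq))
  n*a≡[1+r]*b⇒b≤n (suc n) r eq =
    ∣⇒≤ (coprime-divisor (Coprimality.sym coprime) (divides (suc r) (trans (*-comm a (suc n)) eq)))

  i*a≡l*a+[1+r]*b⇒b≤i : ∀ i l r → i * a ≡ l * a + suc r * b → b ≤ i
  i*a≡l*a+[1+r]*b⇒b≤i i l r eq = ≤-trans (n*a≡[1+r]*b⇒b≤n (i ∸ l) r (begin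
    (i ∸ l) * a                 ≡⟨ *-distribʳ-∸ a i l ⟩
    i * a ∸ l * a               ≡⟨ cong (_∸ l * a) eq ⟩
    l * a + suc r * b ∸ l * a   ≡⟨ m+n∸m≡n (l * a) (suc r * b) ⟩
    suc r * b                   ∎)) (m∸n≤m i l)
    where open ≡-Reasoning

  b-coeff≤canonical : ∀ {i} j l m → i < b →
                      i * a + j * b ≡ l * a + m * b → m ≤ j
  b-coeff≤canonical {i} j l m i<b eq = ≮⇒≥ j≮m
    where
    open ≡-Reasoning
    j≮m : ¬ j < m
    j≮m j<m with r , refl ← m≤n⇒∃[o]m+o≡n j<m =
      <⇒≱ i<b (i*a≡l*a+[1+r]*b⇒b≤i i l r (+-cancelʳ-≡ (j * b) _ _ (begin
        i * a + j * b               ≡⟨ eq ⟩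
        l * a + (suc j + r) * b     ≡⟨ solve (l ∷ a ∷ j ∷ r ∷ b ∷ []) ⟩
        l * a + suc r * b + j * b   ∎)))

  canonical-unique : ∀ .{{_ : NonZero a}} {i} j {i′} j′ → i < b → i′ < b →
                     i * a + j * b ≡ i′ * a + j′ * b → i ≡ i′ × j ≡ j′
  canonical-unique {i} j {i′} j′ i<b i′<b eq = i≡i′ , j≡j′
    where
    j≡j′ : j ≡ j′
    j≡j′ = ≤-antisym (b-coeff≤canonical j′ i j i′<b (sym eq)) (b-coeff≤canonical j i′ j′ i<b eq)
    i≡i′ : i ≡ i′
    i≡i′ = *-cancelʳ-≡ i i′ a (+-cancelʳ-≡ (j * b) _ _
             (trans eq (cong (λ n → i′ * a + n * b) (sym j≡j′))))

  negative-canonical⇒isGap : ∀ {i} j {k x} → i < b → j < k →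
                             x + k * b ≡ i * a + j * b → IsGap (InSemigroup₂ a b) x
  negative-canonical⇒isGap {i} j {k} i<b j<k eq (l , m , refl) =
    <⇒≱ j<k (≤-trans (m≤n+m k m) (b-coeff≤canonical j l (m + k) i<b (sym (begin
      l * a + (m + k) * b     ≡⟨ solve (l ∷ a ∷ m ∷ k ∷ b ∷ []) ⟩
      l * a + m * b + k * b   ≡⟨ eq ⟩
      i * a + j * b           ∎))))
    where open ≡-Reasoning

length-cartesianProductWith : ∀ {A B C : Set} (f : A → B → C) (xs : List A) (ys : List B) →
                              length (cartesianProductWith f xs ys) ≡ length xs * length ys
length-cartesianProductWith f []       ys = refl
length-cartesianProductWith f (x ∷ xs) ys = begin
  length (map (f x) ys ++ cartesianProductWith f xs ys)          ≡⟨ length-++ (map (f x) ys) ⟩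
  length (map (f x) ys) + length (cartesianProductWith f xs ys)  ≡⟨ cong₂ _+_ (length-map (f x) ys)
                                                                      (length-cartesianProductWith f xs ys) ⟩
  length ys + length xs * length ys                              ∎
  where open ≡-Reasoning

hasCardinality-image₂ : ∀ {P : ℕ → Set} {p q} (f : ℕ → ℕ → ℕ) →
  (∀ {k k′ m m′} → k < p → k′ < p → m < q → m′ < q → f k m ≡ f k′ m′ → k ≡ k′ × m ≡ m′) →
  (∀ {k m} → k < p → m < q → P (f k m)) →
  (∀ {x} → P x → ∃₂ λ k m → k < p × m < q × x ≡ f k m) →
  HasCardinality P (p * q)
hasCardinality-image₂ {P} {p} {q} f f-injective image⊆P P⊆image =
  elements , unique , (λ x → mk⇔ ∈⇒P (P⇒∈ {x})) , size
  where
  g : Fin p → Fin q → ℕ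
  g k m = f (toℕ k) (toℕ m)
  elements : List ℕ
  elements = cartesianProductWith g (allFin p) (allFin q)
  unique : Unique elements
  unique = cartesianProductWith⁺ g
    (λ {k} {k′} {m} {m′} → Product.map toℕ-injective toℕ-injective
                          ∘ f-injective (toℕ<n k) (toℕ<n k′) (toℕ<n m) (toℕ<n m′))
    (allFin⁺ p) (allFin⁺ q)
  ∈⇒P : ∀ {x} → x ∈ elements → P x
  ∈⇒P x∈ with k , m , _ , _ , refl ← ∈-cartesianProductWith⁻ g (allFin p) (allFin q) x∈ =
    image⊆P (toℕ<n k) (toℕ<n m)
  P⇒∈ : ∀ {x} → P x → x ∈ elements
  P⇒∈ Px with k , m , k<p , m<q , refl ← P⊆image Px =
    subst₂ (λ k m → f k m ∈ elements) (toℕ-fromℕ< k<p) (toℕ-fromℕ< m<q)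
      (∈-cartesianProductWith⁺ g (∈-allFin (fromℕ< k<p)) (∈-allFin (fromℕ< m<q)))
  size : length elements ≡ p * q
  size = trans (length-cartesianProductWith g (allFin p) (allFin q))
               (cong₂ _*_ (length-tabulate {n = p} id) (length-tabulate {n = q} id))

hasCardinality-resp : ∀ {P Q : ℕ → Set} {n} → (∀ {x} → P x → Q x) → (∀ {x} → Q x → P x) →
                      HasCardinality P n → HasCardinality Q n
hasCardinality-resp P⇒Q Q⇒P (elements , unique , ∈⇔P , size) =
  elements , unique ,
  (λ x → mk⇔ (P⇒Q ∘ Equivalence.to (∈⇔P x)) (Equivalence.from (∈⇔P x) ∘ Q⇒P)) , size

inSemigroup₂-comm : ∀ {a b x} → InSemigroup₂ a b x → InSemigroup₂ b a x
inSemigroup₂-comm {a} {b} (l₁ , l₂ , eq) = l₂ , l₁ , trans eq (+-comm (l₁ * a) (l₂ * b))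

isIsolatedGap-comm : ∀ {a b x} → IsIsolatedGap (InSemigroup₂ a b) x → IsIsolatedGap (InSemigroup₂ b a) x
isIsolatedGap-comm (x∉S , y , (x≡1+y , y∈S) , 1+x∈S) =
  x∉S ∘ inSemigroup₂-comm , y , (x≡1+y , inSemigroup₂-comm y∈S) , inSemigroup₂-comm 1+x∈S

module IsolatedGaps {a b p q d e : ℕ} .{{_ : NonZero a}} (coprime : Coprime a b)
  (bezout : p * a ≡ q * b + 1) (b-split : p + p + e ≡ b) (a-split : q + q + d ≡ a) where

  open ≡-Reasoning

  S : ℕ → Set
  S = InSemigroup₂ a b

  gap : ℕ → ℕ → ℕ
  gap k m = suc ((e + k) * a + m * b)

  e*a+2≡d*b : e * a + 2 ≡ d * b
  e*a+2≡d*b = +-cancelʳ-≡ (q * b + q * b) _ _ (begin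
    e * a + 2 + (q * b + q * b)          ≡⟨ solve (e ∷ a ∷ q ∷ b ∷ []) ⟩
    e * a + (q * b + 1) + (q * b + 1)    ≡⟨ cong₂ (λ x y → e * a + x + y) bezout bezout ⟨
    e * a + p * a + p * a                ≡⟨ solve (e ∷ a ∷ p ∷ []) ⟩
    (p + p + e) * a                      ≡⟨ cong (_* a) b-split ⟩
    b * a                                ≡⟨ cong (b *_) a-split ⟨
    b * (q + q + d)                      ≡⟨ solve (b ∷ q ∷ d ∷ []) ⟩
    d * b + (q * b + q * b)              ∎)

  e+p+p≡b : e + p + p ≡ b
  e+p+p≡b = begin
    e + p + p   ≡⟨ solve (e ∷ p ∷ []) ⟩
    p + p + e   ≡⟨ b-split ⟩
    b           ∎

  n<e+p⇒n+p<b : ∀ {n} → n < e + p → n + p < b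
  n<e+p⇒n+p<b {n} n<e+p = subst (n + p <_) e+p+p≡b (+-monoˡ-< p n<e+p)

  gap-isolated : ∀ {k m} → k < p → m < q → IsIsolatedGap S (gap k m)
  gap-isolated {k} {m} k<p m<q = gap∉S , _ , (refl , e + k , m , refl) , 1+gap∈S
    where
    gap∉S : IsGap S (gap k m)
    gap∉S = negative-canonical⇒isGap coprime m (n<e+p⇒n+p<b (+-monoʳ-< e k<p)) m<q (begin
      suc ((e + k) * a + m * b) + q * b     ≡⟨ solve (e ∷ k ∷ a ∷ m ∷ b ∷ q ∷ []) ⟩
      (e + k) * a + m * b + (q * b + 1)     ≡⟨ cong (_+_ ((e + k) * a + m * b)) bezout ⟨
      (e + k) * a + m * b + p * a           ≡⟨ solve (e ∷ k ∷ a ∷ m ∷ b ∷ p ∷ []) ⟩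
      (e + k + p) * a + m * b               ∎)
    1+gap∈S : S (suc (gap k m))
    1+gap∈S = k , m + d , (begin
      suc (suc ((e + k) * a + m * b)) ≡⟨ solve (e ∷ k ∷ a ∷ m ∷ b ∷ []) ⟩
      k * a + m * b + (e * a + 2)     ≡⟨ cong (_+_ (k * a + m * b)) e*a+2≡d*b ⟩
      k * a + m * b + d * b           ≡⟨ solve (k ∷ a ∷ m ∷ b ∷ d ∷ []) ⟩
      k * a + (m + d) * b             ∎)

  gap⇒j<q : ∀ {i j} → IsGap S (suc (i * a + j * b)) → j < q
  gap⇒j<q {i} {j} x∉S = ≰⇒> λ q≤j → x∉S (lower-b-coeff q≤j)
    where
    lower-b-coeff : q ≤ j → S (suc (i * a + j * b))
    lower-b-coeff q≤j with t , refl ← m≤n⇒∃[o]m+o≡n q≤j = i + p , t , (begin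
      suc (i * a + (q + t) * b)       ≡⟨ solve (i ∷ a ∷ q ∷ t ∷ b ∷ []) ⟩
      i * a + t * b + (q * b + 1)     ≡⟨ cong (_+_ (i * a + t * b)) bezout ⟨
      i * a + t * b + p * a           ≡⟨ solve (i ∷ a ∷ t ∷ b ∷ p ∷ []) ⟩
      (i + p) * a + t * b             ∎)

  gap⇒i<e+p : ∀ {i j} → IsGap S (suc (i * a + j * b)) → i < e + p
  gap⇒i<e+p {i} {j} x∉S = ≰⇒> λ e+p≤i → x∉S (lower-a-coeff e+p≤i)
    where
    lower-a-coeff : e + p ≤ i → S (suc (i * a + j * b))
    lower-a-coeff e+p≤i with t , refl ← m≤n⇒∃[o]m+o≡n e+p≤i = t , j + q + d , (begin
      suc ((e + p + t) * a + j * b)               ≡⟨ solve (e ∷ p ∷ t ∷ a ∷ j ∷ b ∷ []) ⟩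
      t * a + j * b + e * a + p * a + 1           ≡⟨ cong (λ n → t * a + j * b + e * a + n + 1) bezout ⟩
      t * a + j * b + e * a + (q * b + 1) + 1     ≡⟨ solve (t ∷ a ∷ j ∷ b ∷ e ∷ q ∷ []) ⟩
      t * a + (j + q) * b + (e * a + 2)           ≡⟨ cong (_+_ (t * a + (j + q) * b)) e*a+2≡d*b ⟩
      t * a + (j + q) * b + d * b                 ≡⟨ solve (t ∷ a ∷ j ∷ q ∷ b ∷ d ∷ []) ⟩
      t * a + (j + q + d) * b                     ∎)

  isolated⇒e≤i : ∀ {i j} → IsGap S (suc (i * a + j * b)) → S (suc (suc (i * a + j * b))) → e ≤ i
  isolated⇒e≤i {i} {j} x∉S 1+x∈S = ≮⇒≥ λ i<e → negative-canonical⇒isGap coprime j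
    (n<e+p⇒n+p<b (+-monoˡ-< p i<e)) (≤-trans (gap⇒j<q {i} x∉S) (m≤m+n q q)) (begin
      suc (suc (i * a + j * b)) + (q + q) * b         ≡⟨ solve (i ∷ a ∷ j ∷ b ∷ q ∷ []) ⟩
      i * a + j * b + (q * b + 1) + (q * b + 1)       ≡⟨ cong₂ (λ x y → i * a + j * b + x + y) bezout bezout ⟨
      i * a + j * b + p * a + p * a                   ≡⟨ solve (i ∷ a ∷ j ∷ b ∷ p ∷ []) ⟩
      (i + p + p) * a + j * b                         ∎) 1+x∈S

  isolated⇒gap : ∀ {x} → IsIsolatedGap S x → ∃₂ λ k m → k < p × m < q × x ≡ gap k m
  isolated⇒gap (x∉S , _ , (refl , i , j , refl) , 1+x∈S)
    with k , refl ← m≤n⇒∃[o]m+o≡n (isolated⇒e≤i {i} {j} x∉S 1+x∈S) =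
    k , j , +-cancelˡ-< e k p (gap⇒i<e+p {e + k} {j} x∉S) , gap⇒j<q {e + k} {j} x∉S , refl

  gap-injective : ∀ {k k′ m m′} → k < p → k′ < p → gap k m ≡ gap k′ m′ → k ≡ k′ × m ≡ m′
  gap-injective {k} {k′} {m} {m′} k<p k′<p =
    Product.map₁ (+-cancelˡ-≡ e k k′)
    ∘ canonical-unique coprime m m′ (e+k<b k<p) (e+k<b k′<p)
    ∘ suc-injective
    where
    e+k<b : ∀ {k} → k < p → e + k < b
    e+k<b {k} k<p = ≤-<-trans (m≤m+n (e + k) p) (n<e+p⇒n+p<b (+-monoʳ-< e k<p))

  cardinality : HasCardinality (IsIsolatedGap S) (p * q)
  cardinality = hasCardinality-image₂ gap
    (λ k<p k′<p _ _ → gap-injective k<p k′<p) gap-isolated isolated⇒gap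

isolatedGaps-cardinality : ∀ {a b} p q .{{_ : NonZero a}} → Coprime a b → p * a ≡ q * b + 1 →
                           p + p ≤ b → q + q ≤ a →
                           HasCardinality (IsIsolatedGap (InSemigroup₂ a b)) (p * q)
isolatedGaps-cardinality {a} {b} p q coprime bezout 2p≤b 2q≤a =
  IsolatedGaps.cardinality {a} {b} {p} {q} coprime bezout
    (proj₂ (m≤n⇒∃[o]m+o≡n 2p≤b)) (proj₂ (m≤n⇒∃[o]m+o≡n 2q≤a))

isSolution-shift⁺ : ∀ A B u v → IsSolution A B u v → IsSolution A B (u ℤ.+ B) (v ℤ.- A)
isSolution-shift⁺ A B u v sol = begin
  A ℤ.* (u ℤ.+ B) ℤ.+ B ℤ.* (v ℤ.- A)   ≡⟨ ℤSolver.solve (A ∷ B ∷ u ∷ v ∷ []) ⟩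
  A ℤ.* u ℤ.+ B ℤ.* v                   ≡⟨ sol ⟩
  + 1                                   ∎
  where open ≡-Reasoning

isSolution-shift⁻ : ∀ A B u v → IsSolution A B u v → IsSolution A B (u ℤ.- B) (v ℤ.+ A)
isSolution-shift⁻ A B u v sol = begin
  A ℤ.* (u ℤ.- B) ℤ.+ B ℤ.* (v ℤ.+ A)   ≡⟨ ℤSolver.solve (A ∷ B ∷ u ∷ v ∷ []) ⟩
  A ℤ.* u ℤ.+ B ℤ.* v                   ≡⟨ sol ⟩
  + 1                                   ∎
  where open ≡-Reasoning

m≤∣m⊖n∣⇒m+m≤n : ∀ {m n} → 0 < n → m ≤ ℤ.∣ m ⊖ n ∣ → m + m ≤ n
m≤∣m⊖n∣⇒m+m≤n {m} {n} 0<n m≤∣m⊖n∣ with m <? n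
... | yes m<n = begin
  m + m         ≤⟨ +-monoʳ-≤ m (subst (m ≤_) (ℤP.∣⊖∣-< m<n) m≤∣m⊖n∣) ⟩
  m + (n ∸ m)   ≡⟨ m+[n∸m]≡n (<⇒≤ m<n) ⟩
  n             ∎
  where open ≤-Reasoning
... | no m≮n =
  contradiction (subst (m ≤_) (cong ℤ.∣_∣ (ℤP.⊖-≥ n≤m)) m≤∣m⊖n∣) (<⇒≱ (∸-monoʳ-< 0<n n≤m))
  where
  n≤m : n ≤ m
  n≤m = ≮⇒≥ m≮n

∣i∣≤∣i±n∣⇒∣i∣+∣i∣≤n : ∀ i {n} → 0 < n → ℤ.∣ i ∣ ≤ ℤ.∣ i ℤ.- + n ∣ → ℤ.∣ i ∣ ≤ ℤ.∣ i ℤ.+ + n ∣ →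
                      ℤ.∣ i ∣ + ℤ.∣ i ∣ ≤ n
∣i∣≤∣i±n∣⇒∣i∣+∣i∣≤n (+ m)      {n} 0<n below _ =
  m≤∣m⊖n∣⇒m+m≤n 0<n (subst (λ j → m ≤ ℤ.∣ j ∣) (ℤP.[+m]-[+n]≡m⊖n m n) below)
∣i∣≤∣i±n∣⇒∣i∣+∣i∣≤n -[1+ m ]   {n} 0<n _ above =
  m≤∣m⊖n∣⇒m+m≤n 0<n (subst (suc m ≤_) (ℤP.∣m⊖n∣≡∣n⊖m∣ n (suc m)) above)

definitelyLeast⇒half-bounds : ∀ {a b u v} → 0 < a → 0 < b →
                              IsDefinitelyLeastSolution (+ a) (+ b) u v →
                              ℤ.∣ u ∣ + ℤ.∣ u ∣ ≤ b × ℤ.∣ v ∣ + ℤ.∣ v ∣ ≤ a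
definitelyLeast⇒half-bounds {a} {b} {u} {v} 0<a 0<b (sol , least) =
  ∣i∣≤∣i±n∣⇒∣i∣+∣i∣≤n u 0<b (proj₁ down) (proj₁ up) ,
  ∣i∣≤∣i±n∣⇒∣i∣+∣i∣≤n v 0<a (proj₂ up) (proj₂ down)
  where
  up : ℤ.∣ u ∣ ≤ ℤ.∣ u ℤ.+ + b ∣ × ℤ.∣ v ∣ ≤ ℤ.∣ v ℤ.- + a ∣
  up = least _ _ (isSolution-shift⁺ (+ a) (+ b) u v sol)
  down : ℤ.∣ u ∣ ≤ ℤ.∣ u ℤ.- + b ∣ × ℤ.∣ v ∣ ≤ ℤ.∣ v ℤ.+ + a ∣
  down = least _ _ (isSolution-shift⁻ (+ a) (+ b) u v sol)

+[m*a]≡+a*+m : ∀ m a → + (m * a) ≡ + a ℤ.* + m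
+[m*a]≡+a*+m m a = trans (cong +_ (*-comm m a)) (ℤP.pos-* a m)

nonnegative-combination≢1 : ∀ {a b} → 1 < a → 1 < b → ∀ m n → m * a + n * b ≢ 1
nonnegative-combination≢1     _   1<b zero    n eq = <⇒≢ 1<b (sym (m*n≡1⇒n≡1 n _ eq))
nonnegative-combination≢1 {a} {b} 1<a _   (suc m) n eq =
  <⇒≱ 1<a (subst (a ≤_) eq (≤-trans (m≤m+n a (m * a)) (m≤m+n (a + m * a) (n * b))))

mixed-solution : ∀ {a b} m n → + a ℤ.* + m ℤ.+ + b ℤ.* ℤ.- + n ≡ + 1 → m * a ≡ n * b + 1
mixed-solution {a} {b} m n sol = ℤP.+-injective (begin
  + (m * a)                                              ≡⟨ +[m*a]≡+a*+m m a ⟩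
  + a ℤ.* + m                                            ≡⟨ rearrange (+ a) (+ b) (+ m) (+ n) ⟩
  (+ a ℤ.* + m ℤ.+ + b ℤ.* ℤ.- + n) ℤ.+ + b ℤ.* + n      ≡⟨ cong (λ i → i ℤ.+ + b ℤ.* + n) sol ⟩
  + 1 ℤ.+ + b ℤ.* + n                                    ≡⟨ ℤP.+-comm (+ 1) (+ b ℤ.* + n) ⟩
  + b ℤ.* + n ℤ.+ + 1                                    ≡⟨ cong (λ i → i ℤ.+ + 1) (+[m*a]≡+a*+m n b) ⟨
  + (n * b + 1)                                          ∎)
  where
  open ≡-Reasoning
  rearrange : ∀ a b m n → a ℤ.* m ≡ (a ℤ.* m ℤ.+ b ℤ.* ℤ.- n) ℤ.+ b ℤ.* n
  rearrange = ℤSolver.solve-∀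

opposite-signs : ∀ {a b u v} → 1 < a → 1 < b → IsSolution (+ a) (+ b) u v →
                 ℤ.∣ u ∣ * a ≡ ℤ.∣ v ∣ * b + 1 ⊎ ℤ.∣ v ∣ * b ≡ ℤ.∣ u ∣ * a + 1
opposite-signs {a} {b} {+ m}      {+ n}      1<a 1<b sol =
  contradiction (ℤP.+-injective (trans nonnegative-combination sol))
                (nonnegative-combination≢1 1<a 1<b m n)
  where
  nonnegative-combination : + (m * a + n * b) ≡ + a ℤ.* + m ℤ.+ + b ℤ.* + n
  nonnegative-combination =
    trans (ℤP.pos-+ (m * a) (n * b)) (cong₂ ℤ._+_ (+[m*a]≡+a*+m m a) (+[m*a]≡+a*+m n b))
opposite-signs         {u = + m}      { -[1+ n ]} _ _ sol = inj₁ (mixed-solution m (suc n) sol)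
opposite-signs {a} {b} {u = -[1+ m ]} {+ n}      _ _ sol =
  inj₂ (mixed-solution n (suc m) (trans (ℤP.+-comm (+ b ℤ.* + n) (+ a ℤ.* -[1+ m ])) sol))
opposite-signs {suc a} {suc b} { -[1+ m ]} { -[1+ n ]} _ _ ()

theorem3p4 : (a b : ℕ) → Coprime a b → 1 < a → a < b →
    (u v : ℤ) → IsDefinitelyLeastSolution (+ a) (+ b) u v →
    HasCardinality (IsIsolatedGap (InSemigroup₂ a b)) ℤ.∣ u ℤ.* v ∣
theorem3p4 a b coprime 1<a a<b u v least =
  subst (HasCardinality _) (sym (ℤP.abs-* u v)) (count (opposite-signs 1<a 1<b (proj₁ least)))
  where
  1<b : 1 < b
  1<b = <-trans 1<a a<b
  instance
    a≢0 : NonZero a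
    a≢0 = >-nonZero (<-trans z<s 1<a)
    b≢0 : NonZero b
    b≢0 = >-nonZero (<-trans z<s 1<b)
  halves : ℤ.∣ u ∣ + ℤ.∣ u ∣ ≤ b × ℤ.∣ v ∣ + ℤ.∣ v ∣ ≤ a
  halves = definitelyLeast⇒half-bounds (>-nonZero⁻¹ a) (>-nonZero⁻¹ b) least
  count : ℤ.∣ u ∣ * a ≡ ℤ.∣ v ∣ * b + 1 ⊎ ℤ.∣ v ∣ * b ≡ ℤ.∣ u ∣ * a + 1 →
          HasCardinality (IsIsolatedGap (InSemigroup₂ a b)) (ℤ.∣ u ∣ * ℤ.∣ v ∣)
  count (inj₁ bezout) =
    isolatedGaps-cardinality ℤ.∣ u ∣ ℤ.∣ v ∣ coprime bezout (proj₁ halves) (proj₂ halves)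
  count (inj₂ bezout) =
    hasCardinality-resp isIsolatedGap-comm isIsolatedGap-comm
      (subst (HasCardinality _) (*-comm ℤ.∣ v ∣ ℤ.∣ u ∣)
        (isolatedGaps-cardinality ℤ.∣ v ∣ ℤ.∣ u ∣ (Coprimality.sym coprime) bezout
          (proj₂ halves) (proj₁ halves)))
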